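{- For every $r\ge2$ there are exactly $3^{r-1}$ collectable $r$-patterns. Moreover, the sum of the maturities of all collectable $r$-patterns equals $(3^{r-2}-1)/2$.
   Context: An $r$-pattern is an ordered $r$-matching with two edges (two disjoint $r$-sets covering a linearly ordered set of size $2r$), considered up to order-isomorphism, written as a word of length $2r$ in letters $A,B$ each occurring $r$ times (words differing by swapping the letters represent the same pattern). A $P$-clique is an ordered $r$-matching in which every pair of edges is order-isomorphic to $P$. $P$ is collectable if for every $k\ge2$ a $P$-clique of size $k$ exists. The maturity $m(P)$ of a collectable pattern is the length of the last maximal run of equal letters in its word minus $2$, or $0$ if this is negative. -}

module Defs where

open import Data.Nat using (ℕ; zero; suc; _*_; _≤_)
open import Data.Bool using (Bool; true; false; not; _∨_; if_then_else_)
open import Data.Bool.Properties using () renaming (_≟_ to _≟ᵇ_)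
open import Data.Fin using (Fin; _≟_)
open import Data.List using (List; []; _∷_; length; map; filterᵇ; reverse)
open import Data.Product using (Σ; _×_)
open import Data.Maybe using (Maybe; just)
open import Relation.Binary.PropositionalEquality using (_≡_; _≢_)
open import Relation.Nullary.Decidable using (⌊_⌋)

-- Words over the alphabet {A,B}; A is encoded as true, B as false.
Word : Set
Word = List Bool

countOf : {A : Set} → (A → A → Bool) → A → List A → ℕ
countOf eq a xs = length (filterᵇ (eq a) xs)

headW : Word → Maybe Bool
headW [] = Data.Maybe.nothing
headW (x ∷ _) = just x

-- An r-pattern: a word of length 2r with r A's (hence r B's).
-- Patterns are taken up to swapping letters; we use the canonical
-- representative whose first letter is A.
IsPattern : ℕ → Word → Set
IsPattern r w = (length w ≡ 2 * r) × (countOf (λ a b → ⌊ a ≟ᵇ b ⌋) true w ≡ r) × (headW w ≡ just true)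

normalize : Word → Word
normalize [] = []
normalize (true ∷ xs) = true ∷ xs
normalize (false ∷ xs) = map not (false ∷ xs)

-- An ordered r-matching with k edges on the ordered ground set {0,…,kr-1}:
-- position p is labelled by the edge containing it; each edge has exactly r elements.
OrderedMatching : ℕ → ℕ → Set
OrderedMatching k r = Σ (List (Fin k)) λ m → (length m ≡ k * r) × (∀ (i : Fin k) → countOf (λ a b → ⌊ a ≟ b ⌋) i m ≡ r)

pairWord : {k : ℕ} → Fin k → Fin k → List (Fin k) → Word
pairWord i j m = map (λ x → ⌊ x ≟ i ⌋) (filterᵇ (λ x → ⌊ x ≟ i ⌋ ∨ ⌊ x ≟ j ⌋) m)

-- P-clique: every pair of distinct edges is order-isomorphic to P
IsClique : {k r : ℕ} → Word → OrderedMatching k r → Set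
IsClique {k} P M = ∀ (i j : Fin k) → i ≢ j → normalize (pairWord i j (Data.Product.proj₁ M)) ≡ P

Collectable : ℕ → Word → Set
Collectable r P = ∀ (k : ℕ) → 2 ≤ k → Σ (OrderedMatching k r) (IsClique P)

runOf : Bool → Word → ℕ
runOf b [] = zero
runOf b (x ∷ xs) = if ⌊ b ≟ᵇ x ⌋ then suc (runOf b xs) else zero

firstRun : Word → ℕ
firstRun [] = zero
firstRun (x ∷ xs) = suc (runOf x xs)

maturity : Word → ℕ
maturity w = firstRun (reverse w) Data.Nat.∸ 2

{-# OPTIONS --safe #-}
-- Say that a word has a late turn if some
-- prefix u with at least two more c's than (not c)'s is followed by (not c) c. In a clique with three
-- edges, where X contains the first vertex, the pairs XY, XZ and YZ (or ZY) all spell P, so every cut of the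
-- matching yields prefixes of P. The letter counts of the prefixes of P form a chain in ℕ², and cutting
-- around a suitable vertex of Y gives three prefix counts that do not fit into one chain with the counts
-- around a late turn.
-- A balanced word without late turns splits into blocks c^n (not c)^n, and every such block word is
-- collectable: realise c^n (not c)^n by 1^n 2^n … k^n, reversed when c = B, so that every pair of edges
-- spells the block up to swapping letters.
-- The block words of size r arise from AB by r − 1 steps, each lengthening the last block or appending AB
-- or BA, so there are 3^(r−1) of them. A block word ending in c^m (not c)^m has maturity m − 2, so the
-- maturities of the three children of a block word sum to m − 1; the sum of m − 1 over size s grows by
-- 3^(s−1) from s to s + 1, which gives (3^(r−2) − 1)/2 for the total maturity of size r.
module Submission where

open import Data.Bool using (Bool; true; false; not; _∨_; T?; if_then_else_)
open import Data.Bool.Properties using (not-¬; ¬-not; not-injective; not-involutive) renaming (_≟_ to _≟ᵇ_)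
open import Data.Empty using (⊥)
open import Data.Fin using (Fin; zero; suc; _≟_)
import Data.Fin.Properties as Fin
open import Data.List
  using (List; []; _∷_; _++_; _∷ʳ_; length; map; filterᵇ; replicate; reverse; concatMap)
open import Data.List.Properties
  using (filter-++; length-++; length-map; length-replicate; length-reverse; map-++; map-cong; map-id; map-∘;
         reverse-++; reverse-map; reverse-injective; unfold-reverse; ++-assoc; ++-cancelˡ; ++-identityʳ; ∷-injective)
open import Data.List.Membership.Propositional using (_∈_; find; lose)
open import Data.List.Membership.Propositional.Properties using (∈-concatMap⁺; ∈-concatMap⁻; ∈-map⁺; ∈-map⁻)
open import Data.List.Relation.Unary.All using (All; []; _∷_; lookup)
import Data.List.Relation.Unary.All as All
open import Data.List.Relation.Unary.Any using (here; there)
import Data.List.Relation.Unary.AllPairs as AllPairs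
open import Data.List.Relation.Unary.Unique.Propositional using (Unique)
import Data.List.Relation.Unary.Unique.Propositional.Properties as Unique
open import Data.Maybe using (just)
open import Data.Maybe.Properties using (just-injective)
open import Data.Nat using (ℕ; zero; suc; _+_; _*_; _∸_; _^_; _≤_; _<_; z≤n; s≤s; s≤s⁻¹; z<s; _≤?_)
open import Data.Nat.DivMod using (_/_; m*n/n≡m)
open import Data.Nat.Induction using (<-wellFounded)
open import Data.Nat.ListAction using (sum)
open import Data.Nat.ListAction.Properties using (sum-++)
open import Data.Nat.Properties
  using (suc-injective; +-identityʳ; +-suc; +-comm; +-assoc; +-cancelˡ-≡; +-monoʳ-<; *-suc; *-zeroʳ; *-distribˡ-+;
         m+n∸n≡m; m+[n∸m]≡n; m≤m+n; m<n+m; n<1+n; 1+n≰n; ≰⇒>; <⇒≢; <⇒≱; ≤-reflexive; ≤-trans; <-≤-trans;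
         module ≤-Reasoning)
open import Data.Nat.Solver using (module +-*-Solver)
open import Data.Product using (Σ; ∃; ∃₂; _×_; _,_; proj₁; proj₂)
open import Data.Sum using (_⊎_; inj₁; inj₂; [_,_])
open import Function using (_∘_)
open import Function.Bundles using (_⇔_; mk⇔)
open import Induction.WellFounded using (Acc; acc)
open import Relation.Binary.Definitions using (DecidableEquality)
open import Relation.Binary.PropositionalEquality
open import Relation.Nullary using (¬_; Dec; contradiction)
open import Relation.Nullary.Decidable using (⌊_⌋; yes; no)

open import Defs

filterᵇ-∷ : ∀ {A : Set} (p : A → Bool) x xs →
  filterᵇ p (x ∷ xs) ≡ (if p x then x ∷ filterᵇ p xs else filterᵇ p xs)
filterᵇ-∷ p x xs with p x
... | true = refl
... | false = refl

filterᵇ-reverse : ∀ {A : Set} (p : A → Bool) xs → filterᵇ p (reverse xs) ≡ reverse (filterᵇ p xs)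
filterᵇ-reverse p [] = refl
filterᵇ-reverse p (x ∷ xs) = begin
  filterᵇ p (reverse (x ∷ xs))                            ≡⟨ cong (filterᵇ p) (unfold-reverse x xs) ⟩
  filterᵇ p (reverse xs ++ x ∷ [])                        ≡⟨ filter-++ (T? ∘ p) (reverse xs) (x ∷ []) ⟩
  filterᵇ p (reverse xs) ++ filterᵇ p (x ∷ [])            ≡⟨ cong₂ _++_ (filterᵇ-reverse p xs) filterᵇ-singleton ⟩
  reverse (filterᵇ p xs) ++ reverse (filterᵇ p (x ∷ []))  ≡⟨ reverse-++ (filterᵇ p (x ∷ [])) (filterᵇ p xs) ⟨
  reverse (filterᵇ p (x ∷ []) ++ filterᵇ p xs)            ≡⟨ cong reverse (filter-++ (T? ∘ p) (x ∷ []) xs) ⟨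
  reverse (filterᵇ p (x ∷ xs))                            ∎
  where
  open ≡-Reasoning
  filterᵇ-singleton : filterᵇ p (x ∷ []) ≡ reverse (filterᵇ p (x ∷ []))
  filterᵇ-singleton rewrite filterᵇ-∷ p x [] with p x
  ... | true = refl
  ... | false = refl

replicate-+ : ∀ {A : Set} m n (x : A) → replicate (m + n) x ≡ replicate m x ++ replicate n x
replicate-+ zero n x = refl
replicate-+ (suc m) n x = cong (x ∷_) (replicate-+ m n x)

replicate-∷ʳ : ∀ {A : Set} n (x : A) → replicate n x ∷ʳ x ≡ replicate (suc n) x
replicate-∷ʳ zero x = refl
replicate-∷ʳ (suc n) x = cong (x ∷_) (replicate-∷ʳ n x)

reverse-replicate : ∀ {A : Set} n (x : A) → reverse (replicate n x) ≡ replicate n x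
reverse-replicate zero x = refl
reverse-replicate (suc n) x = begin
  reverse (x ∷ replicate n x)   ≡⟨ unfold-reverse x (replicate n x) ⟩
  reverse (replicate n x) ∷ʳ x  ≡⟨ cong (_∷ʳ x) (reverse-replicate n x) ⟩
  replicate n x ∷ʳ x            ≡⟨ replicate-∷ʳ n x ⟩
  replicate (suc n) x           ∎
  where open ≡-Reasoning

module _ {A : Set} (_≟_ : DecidableEquality A) where

  occurrences : A → List A → ℕ
  occurrences = countOf (λ x y → ⌊ x ≟ y ⌋)

  occurrences-++ : ∀ a xs ys → occurrences a (xs ++ ys) ≡ occurrences a xs + occurrences a ys
  occurrences-++ a xs ys =
    trans (cong length (filter-++ _ xs ys)) (length-++ (filterᵇ (λ y → ⌊ a ≟ y ⌋) xs))

  occurrences-reverse : ∀ a xs → occurrences a (reverse xs) ≡ occurrences a xs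
  occurrences-reverse a xs =
    trans (cong length (filterᵇ-reverse _ xs)) (length-reverse (filterᵇ (λ y → ⌊ a ≟ y ⌋) xs))

  occurrences-∷-≡ : ∀ {a x} xs → a ≡ x → occurrences a (x ∷ xs) ≡ suc (occurrences a xs)
  occurrences-∷-≡ {a} xs refl rewrite filterᵇ-∷ (λ y → ⌊ a ≟ y ⌋) a xs with a ≟ a
  ... | yes _ = refl
  ... | no a≢a = contradiction refl a≢a

  occurrences-∷-≢ : ∀ {a x} xs → a ≢ x → occurrences a (x ∷ xs) ≡ occurrences a xs
  occurrences-∷-≢ {a} {x} xs a≢x rewrite filterᵇ-∷ (λ y → ⌊ a ≟ y ⌋) x xs with a ≟ x
  ... | yes a≡x = contradiction a≡x a≢x
  ... | no _ = refl

  occurrences-replicate-same : ∀ a n → occurrences a (replicate n a) ≡ n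
  occurrences-replicate-same a zero = refl
  occurrences-replicate-same a (suc n) =
    trans (occurrences-∷-≡ (replicate n a) refl) (cong suc (occurrences-replicate-same a n))

  occurrences-replicate-other : ∀ {a x} n → a ≢ x → occurrences a (replicate n x) ≡ 0
  occurrences-replicate-other zero a≢x = refl
  occurrences-replicate-other {x = x} (suc n) a≢x =
    trans (occurrences-∷-≢ (replicate n x) a≢x) (occurrences-replicate-other n a≢x)

  occurrences-∷ʳ-≡ : ∀ a xs → occurrences a (xs ∷ʳ a) ≡ suc (occurrences a xs)
  occurrences-∷ʳ-≡ a xs =
    trans (occurrences-++ a xs (a ∷ [])) (trans (cong (occurrences a xs +_) (occurrences-∷-≡ [] refl)) (+-comm _ 1))

  occurrences-∷ʳ-≢ : ∀ {a x} xs → a ≢ x → occurrences a (xs ∷ʳ x) ≡ occurrences a xs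
  occurrences-∷ʳ-≢ {a} {x} xs a≢x =
    trans (occurrences-++ a xs (x ∷ [])) (trans (cong (occurrences a xs +_) (occurrences-∷-≢ [] a≢x)) (+-identityʳ _))

  -- The case split on a ≟ x goes through a helper, since a with-abstraction would also rewrite
  -- inside the unfolded filterᵇ in the type of the hypothesis.
  split-at-occurrence : ∀ a n xs → n < occurrences a xs →
    ∃₂ λ W W′ → xs ≡ W ++ a ∷ W′ × occurrences a W ≡ n
  split-at-occurrence a n (x ∷ xs) = split-∷ n (a ≟ x)
    where
    split-∷ : ∀ n → Dec (a ≡ x) → n < occurrences a (x ∷ xs) →
      ∃₂ λ W W′ → x ∷ xs ≡ W ++ a ∷ W′ × occurrences a W ≡ n
    split-∷ zero (yes a≡x) _ = [] , xs , cong (_∷ xs) (sym a≡x) , refl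
    split-∷ (suc n) (yes a≡x) n<occ
      with split-at-occurrence a n xs (s≤s⁻¹ (subst (suc n <_) (occurrences-∷-≡ xs a≡x) n<occ))
    ... | W , W′ , refl , occW = x ∷ W , W′ , refl , trans (occurrences-∷-≡ W a≡x) (cong suc occW)
    split-∷ n (no a≢x) n<occ
      with split-at-occurrence a n xs (subst (n <_) (occurrences-∷-≢ xs a≢x) n<occ)
    ... | W , W′ , refl , occW = x ∷ W , W′ , refl , trans (occurrences-∷-≢ W a≢x) occW

module _ {A B : Set} (_≟ᴬ_ : DecidableEquality A) (_≟ᴮ_ : DecidableEquality B) {f : A → B} where

  occurrences-map : (∀ {x y} → f x ≡ f y → x ≡ y) → ∀ a xs →
    occurrences _≟ᴮ_ (f a) (map f xs) ≡ occurrences _≟ᴬ_ a xs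
  occurrences-map f-injective a [] = refl
  occurrences-map f-injective a (x ∷ xs) = step (a ≟ᴬ x)
    where
    step : Dec (a ≡ x) → occurrences _≟ᴮ_ (f a) (map f (x ∷ xs)) ≡ occurrences _≟ᴬ_ a (x ∷ xs)
    step (yes a≡x) = trans (occurrences-∷-≡ _≟ᴮ_ (map f xs) (cong f a≡x))
      (trans (cong suc (occurrences-map f-injective a xs)) (sym (occurrences-∷-≡ _≟ᴬ_ xs a≡x)))
    step (no a≢x) = trans (occurrences-∷-≢ _≟ᴮ_ (map f xs) (a≢x ∘ f-injective))
      (trans (occurrences-map f-injective a xs) (sym (occurrences-∷-≢ _≟ᴬ_ xs a≢x)))

  occurrences-map-∉ : ∀ b → (∀ x → b ≢ f x) → ∀ xs → occurrences _≟ᴮ_ b (map f xs) ≡ 0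
  occurrences-map-∉ b b∉ [] = refl
  occurrences-map-∉ b b∉ (x ∷ xs) = trans (occurrences-∷-≢ _≟ᴮ_ (map f xs) (b∉ x)) (occurrences-map-∉ b b∉ xs)

count : Bool → Word → ℕ
count = occurrences _≟ᵇ_

count-++ : ∀ c u v → count c (u ++ v) ≡ count c u + count c v
count-++ = occurrences-++ _≟ᵇ_

count-true+count-false : ∀ w → count true w + count false w ≡ length w
count-true+count-false [] = refl
count-true+count-false (true ∷ w) = cong suc (count-true+count-false w)
count-true+count-false (false ∷ w) =
  trans (+-suc (count true w) (count false w)) (cong suc (count-true+count-false w))

runs : Bool → ℕ → ℕ → Word
runs c a b = replicate a c ++ replicate b (not c)

count-runs : ∀ c a b → count c (runs c a b) ≡ a × count (not c) (runs c a b) ≡ b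
count-runs c a b =
  trans (count-++ c (replicate a c) _)
    (trans (cong₂ _+_ (occurrences-replicate-same _≟ᵇ_ c a) (occurrences-replicate-other _≟ᵇ_ b (not-¬ refl)))
           (+-identityʳ a))
  , trans (count-++ (not c) (replicate a c) _)
      (cong₂ _+_ (occurrences-replicate-other _≟ᵇ_ a (not-¬ refl ∘ sym)) (occurrences-replicate-same _≟ᵇ_ (not c) b))

Balanced : Word → Set
Balanced w = count true w ≡ count false w

balanced-not : ∀ w → Balanced w → ∀ c → count c w ≡ count (not c) w
balanced-not w bal true = bal
balanced-not w bal false = sym bal

balanced-++⁻ʳ : ∀ u {v} → Balanced u → Balanced (u ++ v) → Balanced v
balanced-++⁻ʳ u {v} balᵤ bal = +-cancelˡ-≡ (count true u) _ _ (begin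
  count true u + count true v   ≡⟨ count-++ true u v ⟨
  count true (u ++ v)           ≡⟨ bal ⟩
  count false (u ++ v)          ≡⟨ count-++ false u v ⟩
  count false u + count false v ≡⟨ cong (_+ count false v) balᵤ ⟨
  count true u + count false v  ∎)
  where open ≡-Reasoning

Block : Set
Block = Bool × ℕ

blockWord : Block → Word
blockWord (c , n) = runs c (suc n) (suc n)

-- Block lists are stored last block first, so that the generating steps below act on the head.
wordOf : List Block → Word
wordOf [] = []
wordOf (y ∷ bs) = wordOf bs ++ blockWord y

weight : List Block → ℕ
weight [] = 0
weight ((_ , n) ∷ bs) = suc n + weight bs

count-blockWord : ∀ d y → count d (blockWord y) ≡ suc (proj₂ y)
count-blockWord true (true , n) = proj₁ (count-runs true (suc n) (suc n))
count-blockWord false (true , n) = proj₂ (count-runs true (suc n) (suc n))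
count-blockWord true (false , n) = proj₂ (count-runs false (suc n) (suc n))
count-blockWord false (false , n) = proj₁ (count-runs false (suc n) (suc n))

balanced-blockWord : ∀ y → Balanced (blockWord y)
balanced-blockWord y = trans (count-blockWord true y) (sym (count-blockWord false y))

count-wordOf : ∀ d bs → count d (wordOf bs) ≡ weight bs
count-wordOf d [] = refl
count-wordOf d (y ∷ bs) =
  trans (count-++ d (wordOf bs) (blockWord y))
    (trans (cong₂ _+_ (count-wordOf d bs) (count-blockWord d y)) (+-comm (weight bs) _))

length-wordOf : ∀ bs → length (wordOf bs) ≡ weight bs + weight bs
length-wordOf bs = begin
  length (wordOf bs)                               ≡⟨ count-true+count-false (wordOf bs) ⟨
  count true (wordOf bs) + count false (wordOf bs) ≡⟨ cong₂ _+_ (count-wordOf true bs) (count-wordOf false bs) ⟩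
  weight bs + weight bs                            ∎
  where open ≡-Reasoning

wordOf-∷ʳ : ∀ bs y → wordOf (bs ∷ʳ y) ≡ blockWord y ++ wordOf bs
wordOf-∷ʳ [] y = sym (++-identityʳ (blockWord y))
wordOf-∷ʳ (z ∷ bs) y =
  trans (cong (_++ blockWord z) (wordOf-∷ʳ bs y)) (++-assoc (blockWord y) (wordOf bs) (blockWord z))

blockWordʳ : Block → Word
blockWordʳ (c , n) = replicate (suc n) (not c) ++ replicate (suc n) c

reverse-blockWord : ∀ y → reverse (blockWord y) ≡ blockWordʳ y
reverse-blockWord (c , n) =
  trans (reverse-++ (replicate (suc n) c) _)
    (cong₂ _++_ (reverse-replicate (suc n) (not c)) (reverse-replicate (suc n) c))

reverse-wordOf-∷ : ∀ y bs → reverse (wordOf (y ∷ bs)) ≡ blockWordʳ y ++ reverse (wordOf bs)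
reverse-wordOf-∷ y bs =
  trans (reverse-++ (wordOf bs) (blockWord y)) (cong (_++ reverse (wordOf bs)) (reverse-blockWord y))

runOf-replicate : ∀ c n w → runOf c (replicate n c ++ not c ∷ w) ≡ n
runOf-replicate true zero w = refl
runOf-replicate false zero w = refl
runOf-replicate true (suc n) w = cong suc (runOf-replicate true n w)
runOf-replicate false (suc n) w = cong suc (runOf-replicate false n w)

firstRun-blockWordʳ : ∀ y w → firstRun (blockWordʳ y ++ w) ≡ suc (proj₂ y)
firstRun-blockWordʳ (true , n) w =
  cong suc (trans (cong (runOf false) (++-assoc (replicate n false) (replicate (suc n) true) w))
                  (runOf-replicate false n _))
firstRun-blockWordʳ (false , n) w =
  cong suc (trans (cong (runOf true) (++-assoc (replicate n true) (replicate (suc n) false) w))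
                  (runOf-replicate true n _))

blockWordʳ-++-injective : ∀ {y z} u v → blockWordʳ y ++ u ≡ blockWordʳ z ++ v → y ≡ z
blockWordʳ-++-injective {c , n} {d , m} u v eq = cong₂ _,_
  (not-injective (proj₁ (∷-injective eq)))
  (suc-injective (trans (sym (firstRun-blockWordʳ (c , n) u))
                        (trans (cong firstRun eq) (firstRun-blockWordʳ (d , m) v))))

wordOf-injective : ∀ bs cs → wordOf bs ≡ wordOf cs → bs ≡ cs
wordOf-injective [] [] _ = refl
wordOf-injective [] ((d , m) ∷ cs) eq with trans (cong reverse eq) (reverse-wordOf-∷ (d , m) cs)
... | ()
wordOf-injective ((c , n) ∷ bs) [] eq with trans (sym (reverse-wordOf-∷ (c , n) bs)) (cong reverse eq)
... | ()
wordOf-injective (y ∷ bs) (z ∷ cs) eq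
  with eqʳ ← trans (sym (reverse-wordOf-∷ y bs)) (trans (cong reverse eq) (reverse-wordOf-∷ z cs))
  with refl ← blockWordʳ-++-injective {y} {z} _ _ eqʳ
  = cong (y ∷_) (wordOf-injective bs cs (reverse-injective (++-cancelˡ (blockWordʳ y) _ _ eqʳ)))

Blocks⁺ : Set
Blocks⁺ = Block × List Block

word⁺ : Blocks⁺ → Word
word⁺ (y , bs) = wordOf (y ∷ bs)

weight⁺ : Blocks⁺ → ℕ
weight⁺ (y , bs) = weight (y ∷ bs)

firstLetterOf : Block → List Block → Bool
firstLetterOf (c , _) [] = c
firstLetterOf _ (y ∷ bs) = firstLetterOf y bs

firstLetter : Blocks⁺ → Bool
firstLetter (y , bs) = firstLetterOf y bs

lastExponent : Blocks⁺ → ℕ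
lastExponent ((_ , n) , _) = n

headW-++ : ∀ {u} v {a} → headW u ≡ just a → headW (u ++ v) ≡ just a
headW-++ {_ ∷ _} v eq = eq

headW-true : ∀ w → headW w ≡ just true → ∃ λ w′ → w ≡ true ∷ w′
headW-true (true ∷ w′) refl = w′ , refl

headW-word⁺ : ∀ x → headW (word⁺ x) ≡ just (firstLetter x)
headW-word⁺ (y , bs) = headW-wordOf y bs
  where
  headW-wordOf : ∀ y bs → headW (wordOf (y ∷ bs)) ≡ just (firstLetterOf y bs)
  headW-wordOf (c , n) [] = refl
  headW-wordOf z (y ∷ bs) = headW-++ (blockWord z) (headW-wordOf y bs)

maturity-word⁺ : ∀ c n bs → maturity (word⁺ ((c , n) , bs)) ≡ n ∸ 1
maturity-word⁺ c n bs =
  cong (_∸ 2) (trans (cong firstRun (reverse-wordOf-∷ (c , n) bs)) (firstRun-blockWordʳ (c , n) _))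

word⁺-injective : ∀ {x y} → word⁺ x ≡ word⁺ y → x ≡ y
word⁺-injective {y , bs} {z , cs} eq
  with refl , refl ← ∷-injective (wordOf-injective (y ∷ bs) (z ∷ cs) eq) = refl

-- The generation tree of block words

grow : Blocks⁺ → Blocks⁺
grow ((c , n) , bs) = (c , suc n) , bs

append : Bool → Blocks⁺ → Blocks⁺
append c (y , bs) = (c , 0) , y ∷ bs

children : Blocks⁺ → List Blocks⁺
children x = grow x ∷ append true x ∷ append false x ∷ []

generation : ℕ → List Blocks⁺
generation zero = ((true , 0) , []) ∷ []
generation (suc t) = concatMap children (generation t)

length-generation : ∀ t → length (generation t) ≡ 3 ^ t
length-generation zero = refl
length-generation (suc t) = trans (length-concatMap-children (generation t)) (cong (3 *_) (length-generation t))
  where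
  length-concatMap-children : ∀ xs → length (concatMap children xs) ≡ 3 * length xs
  length-concatMap-children [] = refl
  length-concatMap-children (x ∷ xs) =
    trans (cong (3 +_) (length-concatMap-children xs)) (sym (*-suc 3 (length xs)))

parent : Blocks⁺ → Blocks⁺
parent ((c , suc n) , bs) = (c , n) , bs
parent ((c , zero) , []) = (c , zero) , []
parent ((_ , zero) , y ∷ bs) = y , bs

parent-children : ∀ {x v} → v ∈ children x → parent v ≡ x
parent-children (here refl) = refl
parent-children (there (here refl)) = refl
parent-children (there (there (here refl))) = refl

children-unique : ∀ x → Unique (children x)
children-unique x = ((λ ()) ∷ (λ ()) ∷ []) AllPairs.∷ ((λ ()) ∷ []) AllPairs.∷ [] AllPairs.∷ AllPairs.[]

concatMap-unique : ∀ {A B : Set} (f : A → List B) (g : B → A) →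
  (∀ {x v} → v ∈ f x → g v ≡ x) → (∀ x → Unique (f x)) → ∀ {xs} → Unique xs → Unique (concatMap f xs)
concatMap-unique f g g-inverse unique-f {[]} _ = AllPairs.[]
concatMap-unique f g g-inverse unique-f {x ∷ xs} (x∉xs AllPairs.∷ unique-xs) =
  Unique.++⁺ (unique-f x) (concatMap-unique f g g-inverse unique-f unique-xs) disjoint
  where
  disjoint : ∀ {v} → ¬ (v ∈ f x × v ∈ concatMap f xs)
  disjoint (v∈fx , v∈rest) with x′ , x′∈xs , v∈fx′ ← find (∈-concatMap⁻ f v∈rest) =
    lookup x∉xs (subst (_∈ xs) (trans (sym (g-inverse v∈fx′)) (g-inverse v∈fx)) x′∈xs) refl

generation-unique : ∀ t → Unique (generation t)
generation-unique zero = [] AllPairs.∷ AllPairs.[]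
generation-unique (suc t) =
  concatMap-unique children parent parent-children children-unique (generation-unique t)

children-weight : ∀ {x v} → v ∈ children x → weight⁺ v ≡ suc (weight⁺ x)
children-weight (here refl) = refl
children-weight (there (here refl)) = refl
children-weight (there (there (here refl))) = refl

children-firstLetter : ∀ {x v} → v ∈ children x → firstLetter v ≡ firstLetter x
children-firstLetter {(c , n) , []} (here refl) = refl
children-firstLetter {(c , n) , _ ∷ _} (here refl) = refl
children-firstLetter (there (here refl)) = refl
children-firstLetter (there (there (here refl))) = refl

∈-generation⁻ : ∀ t {x} → x ∈ generation t → weight⁺ x ≡ suc t × firstLetter x ≡ true
∈-generation⁻ zero (here refl) = refl , refl
∈-generation⁻ (suc t) v∈
  with x , x∈ , v∈children ← find (∈-concatMap⁻ children v∈)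
  with weightₓ , letterₓ ← ∈-generation⁻ t x∈
  = trans (children-weight v∈children) (cong suc weightₓ) , trans (children-firstLetter v∈children) letterₓ

child∈generation : ∀ t {x v} → x ∈ generation t → v ∈ children x → v ∈ generation (suc t)
child∈generation t x∈ v∈children = ∈-concatMap⁺ children (lose x∈ v∈children)

∈-generation⁺ : ∀ t x → weight⁺ x ≡ suc t → firstLetter x ≡ true → x ∈ generation t
∈-generation⁺ zero ((true , zero) , []) _ _ = here refl
∈-generation⁺ zero ((_ , suc n) , _) () _
∈-generation⁺ zero ((_ , zero) , (_ , _) ∷ _) () _
∈-generation⁺ (suc t) ((c , suc n) , bs) weight≡ letter≡ =
  child∈generation t (∈-generation⁺ t ((c , n) , bs) (suc-injective weight≡) (trans (sym grow-firstLetter) letter≡))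
    (here refl)
  where grow-firstLetter = children-firstLetter {(c , n) , bs} (here refl)
∈-generation⁺ (suc t) ((_ , zero) , []) () _
∈-generation⁺ (suc t) ((true , zero) , y ∷ bs) weight≡ letter≡ =
  child∈generation t (∈-generation⁺ t (y , bs) (suc-injective weight≡) letter≡) (there (here refl))
∈-generation⁺ (suc t) ((false , zero) , y ∷ bs) weight≡ letter≡ =
  child∈generation t (∈-generation⁺ t (y , bs) (suc-injective weight≡) letter≡) (there (there (here refl)))

sum-map-concatMap : ∀ {A B : Set} (f : B → ℕ) (g : A → List B) xs →
  sum (map f (concatMap g xs)) ≡ sum (map (λ x → sum (map f (g x))) xs)
sum-map-concatMap f g [] = refl
sum-map-concatMap f g (x ∷ xs) =
  trans (cong sum (map-++ f (g x) (concatMap g xs)))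
    (trans (sum-++ (map f (g x)) _) (cong (sum (map f (g x)) +_) (sum-map-concatMap f g xs)))

sum-map-suc : ∀ {A : Set} (f : A → ℕ) xs → sum (map (suc ∘ f) xs) ≡ sum (map f xs) + length xs
sum-map-suc f [] = refl
sum-map-suc f (x ∷ xs) = begin
  suc (f x + sum (map (suc ∘ f) xs))      ≡⟨ cong (λ s → suc (f x + s)) (sum-map-suc f xs) ⟩
  suc (f x + (sum (map f xs) + length xs)) ≡⟨ cong suc (+-assoc (f x) _ _) ⟨
  suc (f x + sum (map f xs) + length xs)   ≡⟨ +-suc (f x + sum (map f xs)) (length xs) ⟨
  f x + sum (map f xs) + suc (length xs)   ∎
  where open ≡-Reasoning

totalExponent : ℕ → ℕ
totalExponent t = sum (map lastExponent (generation t))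

sum-maturity-generation : ∀ t → sum (map (maturity ∘ word⁺) (generation (suc t))) ≡ totalExponent t
sum-maturity-generation t =
  trans (sum-map-concatMap _ children (generation t)) (cong sum (map-cong maturity-children (generation t)))
  where
  maturity-children : ∀ x → sum (map (maturity ∘ word⁺) (children x)) ≡ lastExponent x
  maturity-children ((c , n) , bs) = trans
    (cong₂ _+_ (maturity-word⁺ c (suc n) bs)
      (cong₂ _+_ (maturity-word⁺ true 0 ((c , n) ∷ bs)) (cong (_+ 0) (maturity-word⁺ false 0 ((c , n) ∷ bs)))))
    (+-identityʳ n)

totalExponent-suc : ∀ t → totalExponent (suc t) ≡ totalExponent t + 3 ^ t
totalExponent-suc t = begin
  totalExponent (suc t)                                 ≡⟨ sum-map-concatMap lastExponent children (generation t) ⟩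
  sum (map (λ x → sum (map lastExponent (children x))) (generation t))
    ≡⟨ cong sum (map-cong (λ { ((_ , n) , _) → cong suc (+-identityʳ n) }) (generation t)) ⟩
  sum (map (suc ∘ lastExponent) (generation t))         ≡⟨ sum-map-suc lastExponent (generation t) ⟩
  totalExponent t + length (generation t)               ≡⟨ cong (totalExponent t +_) (length-generation t) ⟩
  totalExponent t + 3 ^ t                               ∎
  where open ≡-Reasoning

totalExponent-closed : ∀ t → totalExponent t * 2 + 1 ≡ 3 ^ t
totalExponent-closed zero = refl
totalExponent-closed (suc t) rewrite totalExponent-suc t | sym (totalExponent-closed t) =
  solve 1 (λ h → (h :+ (h :* con 2 :+ con 1)) :* con 2 :+ con 1 := con 3 :* (h :* con 2 :+ con 1))
    refl (totalExponent t)
  where open +-*-Solver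

totalExponent≡[3^t∸1]/2 : ∀ t → totalExponent t ≡ (3 ^ t ∸ 1) / 2
totalExponent≡[3^t∸1]/2 t = sym (begin
  (3 ^ t ∸ 1) / 2                       ≡⟨ cong (λ s → (s ∸ 1) / 2) (totalExponent-closed t) ⟨
  (totalExponent t * 2 + 1 ∸ 1) / 2     ≡⟨ cong (_/ 2) (m+n∸n≡m (totalExponent t * 2) 1) ⟩
  totalExponent t * 2 / 2               ≡⟨ m*n/n≡m (totalExponent t) 2 ⟩
  totalExponent t                       ∎)
  where open ≡-Reasoning

-- Balanced words without late turns are block words

LateTurnOf : Bool → Word → Set
LateTurnOf c w = ∃₂ λ u v → w ≡ u ++ not c ∷ c ∷ v × suc (count (not c) u) < count c u

LateTurn : Word → Set
LateTurn w = ∃ λ c → LateTurnOf c w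

lateTurn-++ˡ : ∀ u {v} → Balanced u → LateTurn v → LateTurn (u ++ v)
lateTurn-++ˡ u balᵤ (c , s , t , refl , turn) = c , u ++ s , t , sym (++-assoc u s (not c ∷ c ∷ t)) , (begin-strict
  suc (count (not c) (u ++ s))             ≡⟨ cong suc (count-++ (not c) u s) ⟩
  suc (count (not c) u + count (not c) s)  ≡⟨ cong (λ k → suc (k + count (not c) s)) (balanced-not u balᵤ c) ⟨
  suc (count c u + count (not c) s)        ≡⟨ +-suc (count c u) (count (not c) s) ⟨
  count c u + suc (count (not c) s)        <⟨ +-monoʳ-< (count c u) turn ⟩
  count c u + count c s                    ≡⟨ count-++ c u s ⟨
  count c (u ++ s)                         ∎)
  where open ≤-Reasoning

run-split : ∀ c w → ∃₂ λ m R → w ≡ replicate m c ++ R × (R ≡ [] ⊎ ∃ λ R′ → R ≡ not c ∷ R′)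
run-split c [] = 0 , [] , refl , inj₁ refl
run-split c (d ∷ w) with d ≟ᵇ c
... | no d≢c = 0 , d ∷ w , refl , inj₂ (w , cong (_∷ w) (¬-not d≢c))
... | yes refl with m , R , refl , end ← run-split c w = suc m , R , refl , end

runs-+-++ : ∀ c a b d v → runs c a (b + d) ++ v ≡ runs c a b ++ (replicate d (not c) ++ v)
runs-+-++ c a b d v = begin
  (replicate a c ++ replicate (b + d) (not c)) ++ v
    ≡⟨ cong (λ z → (replicate a c ++ z) ++ v) (replicate-+ b d (not c)) ⟩
  (replicate a c ++ (replicate b (not c) ++ replicate d (not c))) ++ v
    ≡⟨ cong (_++ v) (++-assoc (replicate a c) (replicate b (not c)) _) ⟨
  (runs c a b ++ replicate d (not c)) ++ v
    ≡⟨ ++-assoc (runs c a b) (replicate d (not c)) v ⟩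
  runs c a b ++ (replicate d (not c) ++ v) ∎
  where open ≡-Reasoning

runs-suc-++ : ∀ c a b v → runs c a (suc b) ++ v ≡ runs c a b ++ not c ∷ v
runs-suc-++ c a b v = begin
  runs c a (suc b) ++ v             ≡⟨ cong (λ d → runs c a d ++ v) (+-comm 1 b) ⟩
  runs c a (b + 1) ++ v             ≡⟨ runs-+-++ c a b 1 v ⟩
  runs c a b ++ not c ∷ v           ∎
  where open ≡-Reasoning

firstTwoRuns : ∀ c w → Balanced (c ∷ w) →
  ∃₂ λ m j → ∃ λ R → c ∷ w ≡ runs c (suc m) (suc j) ++ R × (R ≡ [] ⊎ ∃ λ R′ → R ≡ c ∷ R′)
firstTwoRuns c w bal with run-split c w
... | m , [] , refl , inj₁ refl =
  contradiction (trans (sym (proj₁ counts)) (trans (balanced-not (c ∷ w) bal c) (proj₂ counts))) λ ()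
  where counts = count-runs c (suc m) 0
... | m , _ , refl , inj₂ (R′ , refl) with run-split (not c) R′
... | j , R , refl , end = m , j , R , eq , subst (λ d → R ≡ [] ⊎ ∃ λ R″ → R ≡ d ∷ R″) (not-involutive c) end
  where
  eq = cong (c ∷_) (sym (++-assoc (replicate m c) (not c ∷ replicate j (not c)) R))

leadingBlock : ∀ c w → Balanced (c ∷ w) → ¬ LateTurn (c ∷ w) →
  ∃₂ λ n rest → c ∷ w ≡ blockWord (c , n) ++ rest
leadingBlock c w bal noTurn with firstTwoRuns c w bal
... | m , j , R , eq , end with m ≤? j
...   | yes m≤j = m , replicate (j ∸ m) (not c) ++ R , (begin
  c ∷ w                                          ≡⟨ eq ⟩
  runs c (suc m) (suc j) ++ R                    ≡⟨ cong (λ k → runs c (suc m) (suc k) ++ R) (m+[n∸m]≡n m≤j) ⟨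
  runs c (suc m) (suc m + (j ∸ m)) ++ R          ≡⟨ runs-+-++ c (suc m) (suc m) (j ∸ m) R ⟩
  blockWord (c , m) ++ replicate (j ∸ m) (not c) ++ R ∎)
  where open ≡-Reasoning
...   | no m≰j = contradiction end secondRunTooShort
  where
  j<m : j < m
  j<m = ≰⇒> m≰j
  -- a second run shorter than the first leaves the word unbalanced or is followed by a late turn
  secondRunTooShort : ¬ (R ≡ [] ⊎ ∃ λ R′ → R ≡ c ∷ R′)
  secondRunTooShort (inj₁ refl) = <⇒≢ (s≤s j<m) (begin
    suc j                                       ≡⟨ proj₂ counts ⟨
    count (not c) (runs c (suc m) (suc j))      ≡⟨ cong (count (not c)) (trans eq (++-identityʳ _)) ⟨
    count (not c) (c ∷ w)                       ≡⟨ balanced-not (c ∷ w) bal c ⟨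
    count c (c ∷ w)                             ≡⟨ cong (count c) (trans eq (++-identityʳ _)) ⟩
    count c (runs c (suc m) (suc j))            ≡⟨ proj₁ counts ⟩
    suc m                                       ∎)
    where
    open ≡-Reasoning
    counts = count-runs c (suc m) (suc j)
  secondRunTooShort (inj₂ (R′ , refl)) = noTurn
    (c , runs c (suc m) j , R′ , trans eq (runs-suc-++ c (suc m) j (c ∷ R′)) ,
     subst₂ _<_ (cong suc (sym (proj₂ counts))) (sym (proj₁ counts)) (s≤s j<m))
    where counts = count-runs c (suc m) j

length-<-blockWord-++ : ∀ y w → length w < length (blockWord y ++ w)
length-<-blockWord-++ y w = subst (length w <_) (sym (length-++ (blockWord y))) (m<n+m (length w) z<s)

decompose : ∀ w → Acc _<_ (length w) → Balanced w → ¬ LateTurn w → ∃ λ bs → wordOf bs ≡ w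
decompose [] _ _ _ = [] , refl
decompose (c ∷ w) (acc shorter) bal noTurn
  with n , rest , refl ← leadingBlock c w bal noTurn
  with bs , refl ← decompose rest (shorter (length-<-blockWord-++ (c , n) rest))
                     (balanced-++⁻ʳ (blockWord (c , n)) (balanced-blockWord (c , n)) bal)
                     (noTurn ∘ lateTurn-++ˡ (blockWord (c , n)) (balanced-blockWord (c , n)))
  = bs ∷ʳ (c , n) , wordOf-∷ʳ bs (c , n)

pattern-count : ∀ {r w} → IsPattern r w → ∀ c → count c w ≡ r
pattern-count (_ , count-true , _) true = count-true
pattern-count {r} {w} (len , count-true , _) false = +-cancelˡ-≡ r _ _ (begin
  r + count false w             ≡⟨ cong (_+ count false w) count-true ⟨
  count true w + count false w  ≡⟨ count-true+count-false w ⟩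
  length w                      ≡⟨ len ⟩
  r + (r + 0)                   ≡⟨ cong (r +_) (+-identityʳ r) ⟩
  r + r                         ∎)
  where open ≡-Reasoning

lateTurn-free⇒∈generation : ∀ t P → IsPattern (suc t) P → ¬ LateTurn P → P ∈ map word⁺ (generation t)
lateTurn-free⇒∈generation t P pat@(_ , _ , head) noTurn
  with decompose P (<-wellFounded (length P)) (trans (pattern-count pat true) (sym (pattern-count pat false))) noTurn
... | [] , refl with () ← head
... | y ∷ bs , refl = ∈-map⁺ word⁺ (∈-generation⁺ t (y , bs)
  (trans (sym (count-wordOf true (y ∷ bs))) (pattern-count pat true))
  (just-injective (trans (sym (headW-word⁺ (y , bs))) head)))

-- Cliques with three edges have no late turns

PrefixCounts : Bool → Word → ℕ → ℕ → Set
PrefixCounts c w a b = ∃₂ λ u v → w ≡ u ++ v × count c u ≡ a × count (not c) u ≡ b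

Chain : (ℕ → ℕ → Set) → Set
Chain R = ∀ {a₁ b₁ a₂ b₂} → R a₁ b₁ → R a₂ b₂ → (a₁ ≤ a₂ × b₁ ≤ b₂) ⊎ (a₂ ≤ a₁ × b₂ ≤ b₁)

++-prefixes-comparable : ∀ {A : Set} (u₁ v₁ u₂ v₂ : List A) → u₁ ++ v₁ ≡ u₂ ++ v₂ →
  (∃ λ s → u₂ ≡ u₁ ++ s) ⊎ (∃ λ s → u₁ ≡ u₂ ++ s)
++-prefixes-comparable [] _ u₂ _ _ = inj₁ (u₂ , refl)
++-prefixes-comparable (x ∷ u₁) _ [] _ _ = inj₂ (x ∷ u₁ , refl)
++-prefixes-comparable (x ∷ u₁) v₁ (y ∷ u₂) v₂ eq with refl , eq′ ← ∷-injective eq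
  with ++-prefixes-comparable u₁ v₁ u₂ v₂ eq′
... | inj₁ (s , refl) = inj₁ (s , refl)
... | inj₂ (s , refl) = inj₂ (s , refl)

count-≤-prefix : ∀ c u {s w} → w ≡ u ++ s → count c u ≤ count c w
count-≤-prefix c u {s} refl = subst (count c u ≤_) (sym (count-++ c u s)) (m≤m+n (count c u) (count c s))

prefixCounts-chain : ∀ c w → Chain (PrefixCounts c w)
prefixCounts-chain c w (u₁ , v₁ , refl , refl , refl) (u₂ , v₂ , eq , refl , refl)
  with ++-prefixes-comparable u₁ v₁ u₂ v₂ eq
... | inj₁ (s , refl) = inj₁ (count-≤-prefix c u₁ refl , count-≤-prefix (not c) u₁ refl)
... | inj₂ (s , refl) = inj₂ (count-≤-prefix c u₂ refl , count-≤-prefix (not c) u₂ refl)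

module _ {R : ℕ → ℕ → Set} (chain : Chain R) where

  chain-monoˡ : ∀ {a₁ b₁ a₂ b₂} → R a₁ b₁ → R a₂ b₂ → a₁ < a₂ → b₁ ≤ b₂
  chain-monoˡ p q a₁<a₂ with chain p q
  ... | inj₁ (_ , b₁≤b₂) = b₁≤b₂
  ... | inj₂ (a₂≤a₁ , _) = contradiction a₂≤a₁ (<⇒≱ a₁<a₂)

  chain-monoʳ : ∀ {a₁ b₁ a₂ b₂} → R a₁ b₁ → R a₂ b₂ → b₁ < b₂ → a₁ ≤ a₂
  chain-monoʳ p q b₁<b₂ with chain p q
  ... | inj₁ (a₁≤a₂ , _) = a₁≤a₂
  ... | inj₂ (_ , b₂≤b₁) = contradiction b₂≤b₁ (<⇒≱ b₁<b₂)

  chain-excludes-turn : ∀ {a b x z} → R a b → R a (suc b) → R (suc a) (suc b) → suc b < a →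
    R x (suc (suc b)) → R (suc b) z → R x z → ⊥
  chain-excludes-turn {b = b} p₁ p₂ p₃ b<a q₁ q₂ q₃ = 1+n≰n (≤-trans b<z z≤b)
    where
    a<x = chain-monoʳ p₃ q₁ (n<1+n (suc b))
    z≤b = chain-monoˡ q₂ p₁ b<a
    b<z = chain-monoˡ p₂ q₃ a<x

prefixCounts-extend : ∀ {c w} u s v → w ≡ u ++ s ++ v →
  PrefixCounts c w (count c u + count c s) (count (not c) u + count (not c) s)
prefixCounts-extend {c} u s v refl = u ++ s , v , sym (++-assoc u s v) , count-++ c u s , count-++ (not c) u s

counts-[not] : ∀ c → count c (not c ∷ []) ≡ 0 × count (not c) (not c ∷ []) ≡ 1
counts-[not] true = refl , refl
counts-[not] false = refl , refl

counts-[not,c] : ∀ c → count c (not c ∷ c ∷ []) ≡ 1 × count (not c) (not c ∷ c ∷ []) ≡ 1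
counts-[not,c] true = refl , refl
counts-[not,c] false = refl , refl

lateTurn-prefixCounts : ∀ {c w} u v → w ≡ u ++ not c ∷ c ∷ v →
  PrefixCounts c w (count c u) (count (not c) u) ×
  PrefixCounts c w (count c u) (suc (count (not c) u)) ×
  PrefixCounts c w (suc (count c u)) (suc (count (not c) u))
lateTurn-prefixCounts {c} u v eq =
  (u , _ , eq , refl , refl) ,
  subst₂ (PrefixCounts c _)
    (trans (cong (count c u +_) (proj₁ (counts-[not] c))) (+-identityʳ _))
    (trans (cong (count (not c) u +_) (proj₂ (counts-[not] c))) (+-comm _ 1))
    (prefixCounts-extend u (not c ∷ []) (c ∷ v) eq) ,
  subst₂ (PrefixCounts c _)
    (trans (cong (count c u +_) (proj₁ (counts-[not,c] c))) (+-comm _ 1))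
    (trans (cong (count (not c) u +_) (proj₂ (counts-[not,c] c))) (+-comm _ 1))
    (prefixCounts-extend u (not c ∷ c ∷ []) v eq)

module _ {k : ℕ} where

  edgeSize : Fin k → List (Fin k) → ℕ
  edgeSize = occurrences _≟_

  pairWord-∷ : ∀ (i j x : Fin k) m →
    pairWord i j (x ∷ m) ≡ (if ⌊ x ≟ i ⌋ ∨ ⌊ x ≟ j ⌋ then ⌊ x ≟ i ⌋ ∷ pairWord i j m else pairWord i j m)
  pairWord-∷ i j x m with ⌊ x ≟ i ⌋ ∨ ⌊ x ≟ j ⌋
  ... | true = refl
  ... | false = refl

  pairWord-first : ∀ (i j : Fin k) m → pairWord i j (i ∷ m) ≡ true ∷ pairWord i j m
  pairWord-first i j m rewrite pairWord-∷ i j i m with i ≟ i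
  ... | yes _ = refl
  ... | no i≢i = contradiction refl i≢i

  pairWord-second : ∀ {i j : Fin k} → i ≢ j → ∀ m → pairWord i j (j ∷ m) ≡ false ∷ pairWord i j m
  pairWord-second {i} {j} i≢j m rewrite pairWord-∷ i j j m with j ≟ i | j ≟ j
  ... | yes j≡i | _ = contradiction (sym j≡i) i≢j
  ... | no _ | yes _ = refl
  ... | no _ | no j≢j = contradiction refl j≢j

  pairWord-neither : ∀ {i j x : Fin k} → x ≢ i → x ≢ j → ∀ m → pairWord i j (x ∷ m) ≡ pairWord i j m
  pairWord-neither {i} {j} {x} x≢i x≢j m rewrite pairWord-∷ i j x m with x ≟ i | x ≟ j
  ... | yes x≡i | _ = contradiction x≡i x≢i
  ... | no _ | yes x≡j = contradiction x≡j x≢j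
  ... | no _ | no _ = refl

  data Role (i j : Fin k) : Fin k → Set where
    first : Role i j i
    second : i ≢ j → Role i j j
    neither : ∀ {x} → x ≢ i → x ≢ j → Role i j x

  role : ∀ i j x → Role i j x
  role i j x with x ≟ i | x ≟ j
  ... | yes refl | _ = first
  ... | no x≢i | yes refl = second (x≢i ∘ sym)
  ... | no x≢i | no x≢j = neither x≢i x≢j

  pairWord-++ : ∀ (i j : Fin k) m m′ → pairWord i j (m ++ m′) ≡ pairWord i j m ++ pairWord i j m′
  pairWord-++ i j m m′ = trans (cong (map (λ x → ⌊ x ≟ i ⌋)) (filter-++ (T? ∘ inPair) m m′)) (map-++ _ (filterᵇ inPair m) _)
    where inPair = λ x → ⌊ x ≟ i ⌋ ∨ ⌊ x ≟ j ⌋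

  pairWord-reverse : ∀ (i j : Fin k) m → pairWord i j (reverse m) ≡ reverse (pairWord i j m)
  pairWord-reverse i j m =
    trans (cong (map (λ x → ⌊ x ≟ i ⌋)) (filterᵇ-reverse inPair m)) (reverse-map _ (filterᵇ inPair m))
    where inPair = λ x → ⌊ x ≟ i ⌋ ∨ ⌊ x ≟ j ⌋

  count-pairWord : ∀ {i j : Fin k} → i ≢ j → ∀ m →
    count true (pairWord i j m) ≡ edgeSize i m × count false (pairWord i j m) ≡ edgeSize j m
  count-pairWord i≢j [] = refl , refl
  count-pairWord {i} {j} i≢j (x ∷ m) with role i j x | count-pairWord i≢j m
  ... | first | #true , #false =
    trans (cong (count true) (pairWord-first i j m)) (trans (cong suc #true) (sym (occurrences-∷-≡ _≟_ m refl))) ,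
    trans (cong (count false) (pairWord-first i j m)) (trans #false (sym (occurrences-∷-≢ _≟_ m (i≢j ∘ sym))))
  ... | second _ | #true , #false =
    trans (cong (count true) (pairWord-second i≢j m)) (trans #true (sym (occurrences-∷-≢ _≟_ m i≢j))) ,
    trans (cong (count false) (pairWord-second i≢j m)) (trans (cong suc #false) (sym (occurrences-∷-≡ _≟_ m refl)))
  ... | neither x≢i x≢j | #true , #false =
    trans (cong (count true) (pairWord-neither x≢i x≢j m)) (trans #true (sym (occurrences-∷-≢ _≟_ m (x≢i ∘ sym)))) ,
    trans (cong (count false) (pairWord-neither x≢i x≢j m)) (trans #false (sym (occurrences-∷-≢ _≟_ m (x≢j ∘ sym))))

  pairWord-swap : ∀ {i j : Fin k} → i ≢ j → ∀ m → pairWord j i m ≡ map not (pairWord i j m)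
  pairWord-swap i≢j [] = refl
  pairWord-swap {i} {j} i≢j (x ∷ m) with role i j x
  ... | first = trans (pairWord-second (i≢j ∘ sym) m)
    (trans (cong (false ∷_) (pairWord-swap i≢j m)) (cong (map not) (sym (pairWord-first i j m))))
  ... | second _ = trans (pairWord-first j i m)
    (trans (cong (true ∷_) (pairWord-swap i≢j m)) (cong (map not) (sym (pairWord-second i≢j m))))
  ... | neither x≢i x≢j = trans (pairWord-neither x≢j x≢i m)
    (trans (pairWord-swap i≢j m) (cong (map not) (sym (pairWord-neither x≢i x≢j m))))

  pairWord-prefixCounts : ∀ {i j : Fin k} {m P} W W′ → i ≢ j → pairWord i j m ≡ P → m ≡ W ++ W′ →
    PrefixCounts true P (edgeSize i W) (edgeSize j W) × PrefixCounts false P (edgeSize j W) (edgeSize i W)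
  pairWord-prefixCounts {i} {j} W W′ i≢j refl refl with #true , #false ← count-pairWord i≢j W =
    (pairWord i j W , pairWord i j W′ , pairWord-++ i j W W′ , #true , #false) ,
    (pairWord i j W , pairWord i j W′ , pairWord-++ i j W W′ , #false , #true)

-- Cut m just before and just after the (b+2)-th vertex of F, where b counts the letters not c before the
-- turn: the three pairs give prefix points (x, b+2), (b+1, z), (x, z) of P, which the turn rules out.
lateTurnOf-excluded : ∀ {k} (m : List (Fin k)) {P c E F G} → E ≢ F → G ≢ F →
  (∀ W W′ → m ≡ W ++ W′ → PrefixCounts c P (edgeSize E W) (edgeSize F W)) →
  (∀ W W′ → m ≡ W ++ W′ → PrefixCounts c P (edgeSize F W) (edgeSize G W)) →
  (∀ W W′ → m ≡ W ++ W′ → PrefixCounts c P (edgeSize E W) (edgeSize G W)) →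
  count c P ≤ edgeSize F m → ¬ LateTurnOf c P
lateTurnOf-excluded m {P} {c} {E} {F} {G} E≢F G≢F EF FG EG c≤F (u , v , eq , turn)
  with W , W′ , refl , #F ← split-at-occurrence _≟_ F (suc (count (not c) u)) m
                              (<-≤-trans turn (≤-trans (count-≤-prefix c u eq) c≤F))
  with p₁ , p₂ , p₃ ← lateTurn-prefixCounts u v eq
  = chain-excludes-turn (prefixCounts-chain c P) p₁ p₂ p₃ turn
      (subst₂ (PrefixCounts c P) (occurrences-∷ʳ-≢ _≟_ W E≢F) (trans (occurrences-∷ʳ-≡ _≟_ F W) (cong suc #F))
        (EF (W ∷ʳ F) W′ (sym (++-assoc W (F ∷ []) W′))))
      (subst (λ a → PrefixCounts c P a (edgeSize G W)) #F (FG W (F ∷ W′) refl))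
      (EG W (F ∷ W′) refl)

orientedTriple-lateTurn-free : ∀ {k} (m : List (Fin k)) {P X Y Z} → X ≢ Y → X ≢ Z → Y ≢ Z →
  pairWord X Y m ≡ P → pairWord X Z m ≡ P → pairWord Y Z m ≡ P →
  (∀ c → count c P ≤ edgeSize Y m) → ¬ LateTurn P
orientedTriple-lateTurn-free m X≢Y X≢Z Y≢Z XY XZ YZ bound (true , turn) =
  lateTurnOf-excluded m X≢Y (Y≢Z ∘ sym)
    (λ W W′ cut → proj₁ (pairWord-prefixCounts W W′ X≢Y XY cut))
    (λ W W′ cut → proj₁ (pairWord-prefixCounts W W′ Y≢Z YZ cut))
    (λ W W′ cut → proj₁ (pairWord-prefixCounts W W′ X≢Z XZ cut))
    (bound true) turn
orientedTriple-lateTurn-free m X≢Y X≢Z Y≢Z XY XZ YZ bound (false , turn) =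
  lateTurnOf-excluded m (Y≢Z ∘ sym) X≢Y
    (λ W W′ cut → proj₂ (pairWord-prefixCounts W W′ Y≢Z YZ cut))
    (λ W W′ cut → proj₂ (pairWord-prefixCounts W W′ X≢Y XY cut))
    (λ W W′ cut → proj₂ (pairWord-prefixCounts W W′ X≢Z XZ cut))
    (bound false) turn

normalize-cases : ∀ w → normalize w ≡ w ⊎ normalize w ≡ map not w
normalize-cases [] = inj₁ refl
normalize-cases (true ∷ w) = inj₁ refl
normalize-cases (false ∷ w) = inj₂ refl

two-others : (X : Fin 3) → ∃₂ λ Y Z → X ≢ Y × X ≢ Z × Y ≢ Z
two-others zero = suc zero , suc (suc zero) , (λ ()) , (λ ()) , (λ ())
two-others (suc zero) = zero , suc (suc zero) , (λ ()) , (λ ()) , (λ ())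
two-others (suc (suc zero)) = zero , suc zero , (λ ()) , (λ ()) , (λ ())

normalize-pairWord-first : ∀ {k} (i j : Fin k) m → normalize (pairWord i j (i ∷ m)) ≡ pairWord i j (i ∷ m)
normalize-pairWord-first i j m = trans (cong normalize (pairWord-first i j m)) (sym (pairWord-first i j m))

clique-lateTurn-free : ∀ {r P} → IsPattern r P → (M : OrderedMatching 3 r) → IsClique P M → ¬ LateTurn P
clique-lateTurn-free _ ([] , _) clique (c , [] , v , eq , _) with () ← trans (clique zero (suc zero) (λ ())) eq
clique-lateTurn-free _ ([] , _) clique (c , _ ∷ _ , v , eq , _) with () ← trans (clique zero (suc zero) (λ ())) eq
clique-lateTurn-free {P = P} pat (X ∷ m , _ , sizes) clique =
  let Y , Z , X≢Y , X≢Z , Y≢Z = two-others X in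
  [_,_] (λ normal → orientedTriple-lateTurn-free (X ∷ m) X≢Y X≢Z Y≢Z (headed X≢Y) (headed X≢Z)
                       (trans (sym normal) (clique Y Z Y≢Z)) (bound Y))
        (λ normal → orientedTriple-lateTurn-free (X ∷ m) X≢Z X≢Y (Y≢Z ∘ sym) (headed X≢Z) (headed X≢Y)
                       (trans (pairWord-swap Y≢Z (X ∷ m)) (trans (sym normal) (clique Y Z Y≢Z))) (bound Z))
        (normalize-cases (pairWord Y Z (X ∷ m)))
  where
  headed : ∀ {Y} → X ≢ Y → pairWord X Y (X ∷ m) ≡ P
  headed {Y} X≢Y = trans (sym (normalize-pairWord-first X Y m)) (clique X Y X≢Y)
  bound : ∀ Y c → count c P ≤ edgeSize Y (X ∷ m)
  bound Y c = ≤-reflexive (trans (pattern-count pat c) (sym (sizes Y)))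

collectable⇒lateTurn-free : ∀ {r P} → IsPattern r P → Collectable r P → ¬ LateTurn P
collectable⇒lateTurn-free pat collectable with M , clique ← collectable 3 (s≤s (s≤s z≤n)) =
  clique-lateTurn-free pat M clique

-- Block words are collectable

module _ {k : ℕ} where

  pairWord-replicate-first : ∀ (i j : Fin k) s → pairWord i j (replicate s i) ≡ replicate s true
  pairWord-replicate-first i j zero = refl
  pairWord-replicate-first i j (suc s) =
    trans (pairWord-first i j (replicate s i)) (cong (true ∷_) (pairWord-replicate-first i j s))

  pairWord-replicate-neither : ∀ {i j x : Fin k} → x ≢ i → x ≢ j → ∀ s → pairWord i j (replicate s x) ≡ []
  pairWord-replicate-neither x≢i x≢j zero = refl
  pairWord-replicate-neither {x = x} x≢i x≢j (suc s) =
    trans (pairWord-neither x≢i x≢j (replicate s x)) (pairWord-replicate-neither x≢i x≢j s)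

  pairWord-map-suc : ∀ (i j : Fin k) xs → pairWord (suc i) (suc j) (map suc xs) ≡ pairWord i j xs
  pairWord-map-suc i j [] = refl
  pairWord-map-suc i j (x ∷ xs) with role i j x
  ... | first = trans (pairWord-first (suc i) (suc j) (map suc xs))
    (trans (cong (true ∷_) (pairWord-map-suc i j xs)) (sym (pairWord-first i j xs)))
  ... | second i≢j = trans (pairWord-second (i≢j ∘ Fin.suc-injective) (map suc xs))
    (trans (cong (false ∷_) (pairWord-map-suc i j xs)) (sym (pairWord-second i≢j xs)))
  ... | neither x≢i x≢j = trans (pairWord-neither (x≢i ∘ Fin.suc-injective) (x≢j ∘ Fin.suc-injective) (map suc xs))
    (trans (pairWord-map-suc i j xs) (sym (pairWord-neither x≢i x≢j xs)))

  pairWord-zero-map-suc : ∀ (j : Fin k) xs → pairWord zero (suc j) (map suc xs) ≡ replicate (edgeSize j xs) false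
  pairWord-zero-map-suc j [] = refl
  pairWord-zero-map-suc j (x ∷ xs) with role zero (suc j) (suc x)
  ... | second _ = trans (pairWord-second (λ ()) (map suc xs))
    (trans (cong (false ∷_) (pairWord-zero-map-suc j xs))
           (cong (λ n → replicate n false) (sym (occurrences-∷-≡ _≟_ xs refl))))
  ... | neither _ sx≢sj = trans (pairWord-neither (λ ()) sx≢sj (map suc xs))
    (trans (pairWord-zero-map-suc j xs)
           (cong (λ n → replicate n false) (sym (occurrences-∷-≢ _≟_ xs (sx≢sj ∘ cong suc ∘ sym)))))

ascending : ℕ → (k : ℕ) → List (Fin k)
ascending s zero = []
ascending s (suc k) = replicate s zero ++ map suc (ascending s k)

length-ascending : ∀ s k → length (ascending s k) ≡ k * s
length-ascending s zero = refl
length-ascending s (suc k) = trans (length-++ (replicate s zero))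
  (cong₂ _+_ (length-replicate s) (trans (length-map suc (ascending s k)) (length-ascending s k)))

edgeSize-ascending : ∀ s k (i : Fin k) → edgeSize i (ascending s k) ≡ s
edgeSize-ascending s (suc k) zero = trans (occurrences-++ _≟_ zero (replicate s zero) _)
  (trans (cong₂ _+_ (occurrences-replicate-same _≟_ zero s) (occurrences-map-∉ _≟_ _≟_ zero (λ _ ()) (ascending s k)))
         (+-identityʳ s))
edgeSize-ascending s (suc k) (suc i) = trans (occurrences-++ _≟_ (suc i) (replicate s zero) _)
  (cong₂ _+_ (occurrences-replicate-other _≟_ s λ ())
             (trans (occurrences-map _≟_ _≟_ Fin.suc-injective i (ascending s k)) (edgeSize-ascending s k i)))

orient : Bool → Word → Word
orient o = map (λ b → if o then b else not b)

pairWord-zero-suc-ascending : ∀ s k (j : Fin k) → pairWord zero (suc j) (ascending s (suc k)) ≡ runs true s s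
pairWord-zero-suc-ascending s k j = trans (pairWord-++ zero (suc j) (replicate s zero) _)
  (cong₂ _++_ (pairWord-replicate-first zero (suc j) s)
              (trans (pairWord-zero-map-suc j (ascending s k)) (cong (λ n → replicate n false) (edgeSize-ascending s k j))))

pairWord-ascending : ∀ {k} {i j : Fin k} → i ≢ j → ∃ λ o → ∀ s → pairWord i j (ascending s k) ≡ orient o (runs true s s)
pairWord-ascending {i = zero} {zero} 0≢0 = contradiction refl 0≢0
pairWord-ascending {suc k} {zero} {suc j} _ = true , λ s →
  trans (pairWord-zero-suc-ascending s k j) (sym (map-id (runs true s s)))
pairWord-ascending {suc k} {suc i} {zero} _ = false , λ s →
  trans (pairWord-swap (λ ()) (ascending s (suc k))) (cong (map not) (pairWord-zero-suc-ascending s k i))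
pairWord-ascending {suc k} {suc i} {suc j} si≢sj with o , asc ← pairWord-ascending (si≢sj ∘ cong suc) = o , λ s →
  trans (pairWord-++ (suc i) (suc j) (replicate s zero) _)
    (trans (cong₂ _++_ (pairWord-replicate-neither (λ ()) (λ ()) s) (pairWord-map-suc i j (ascending s k))) (asc s))

blockMatching : (k : ℕ) → Block → List (Fin k)
blockMatching k (true , n) = ascending (suc n) k
blockMatching k (false , n) = reverse (ascending (suc n) k)

matchingOf : (k : ℕ) → List Block → List (Fin k)
matchingOf k [] = []
matchingOf k (y ∷ bs) = matchingOf k bs ++ blockMatching k y

length-matchingOf : ∀ k bs → length (matchingOf k bs) ≡ k * weight bs
length-matchingOf k [] = sym (*-zeroʳ k)
length-matchingOf k ((c , n) ∷ bs) = begin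
  length (matchingOf k bs ++ blockMatching k (c , n))        ≡⟨ length-++ (matchingOf k bs) ⟩
  length (matchingOf k bs) + length (blockMatching k (c , n)) ≡⟨ cong₂ _+_ (length-matchingOf k bs) (length-block c) ⟩
  k * weight bs + k * suc n                                  ≡⟨ +-comm (k * weight bs) _ ⟩
  k * suc n + k * weight bs                                  ≡⟨ *-distribˡ-+ k (suc n) (weight bs) ⟨
  k * (suc n + weight bs)                                    ∎
  where
  open ≡-Reasoning
  length-block : ∀ c → length (blockMatching k (c , n)) ≡ k * suc n
  length-block true = length-ascending (suc n) k
  length-block false = trans (length-reverse (ascending (suc n) k)) (length-ascending (suc n) k)

edgeSize-matchingOf : ∀ k (i : Fin k) bs → edgeSize i (matchingOf k bs) ≡ weight bs
edgeSize-matchingOf k i [] = refl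
edgeSize-matchingOf k i ((c , n) ∷ bs) =
  trans (occurrences-++ _≟_ i (matchingOf k bs) _)
    (trans (cong₂ _+_ (edgeSize-matchingOf k i bs) (edgeSize-block c)) (+-comm (weight bs) (suc n)))
  where
  edgeSize-block : ∀ c → edgeSize i (blockMatching k (c , n)) ≡ suc n
  edgeSize-block true = edgeSize-ascending (suc n) k i
  edgeSize-block false = trans (occurrences-reverse _≟_ i (ascending (suc n) k)) (edgeSize-ascending (suc n) k i)

pairWord-matchingOf : ∀ {k} {i j : Fin k} → i ≢ j → ∃ λ o → ∀ bs → pairWord i j (matchingOf k bs) ≡ orient o (wordOf bs)
pairWord-matchingOf {k} {i} {j} i≢j with o , asc ← pairWord-ascending i≢j = o , go
  where
  block : ∀ y → pairWord i j (blockMatching k y) ≡ orient o (blockWord y)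
  block (true , n) = asc (suc n)
  block (false , n) = begin
    pairWord i j (reverse (ascending (suc n) k))     ≡⟨ pairWord-reverse i j (ascending (suc n) k) ⟩
    reverse (pairWord i j (ascending (suc n) k))     ≡⟨ cong reverse (asc (suc n)) ⟩
    reverse (orient o (blockWord (true , n)))        ≡⟨ reverse-map _ (blockWord (true , n)) ⟨
    orient o (reverse (blockWord (true , n)))        ≡⟨ cong (orient o) (reverse-blockWord (true , n)) ⟩
    orient o (blockWord (false , n))                 ∎
    where open ≡-Reasoning
  go : ∀ bs → pairWord i j (matchingOf k bs) ≡ orient o (wordOf bs)
  go [] = refl
  go (y ∷ bs) = trans (pairWord-++ i j (matchingOf k bs) _)
    (trans (cong₂ _++_ (go bs) (block y)) (sym (map-++ _ (wordOf bs) (blockWord y))))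

normalize-orient : ∀ o w → normalize (orient o (true ∷ w)) ≡ true ∷ w
normalize-orient true w = cong (true ∷_) (map-id w)
normalize-orient false w = cong (true ∷_) (trans (sym (map-∘ w)) (trans (map-cong not-involutive w) (map-id w)))

blocks-collectable : ∀ x → firstLetter x ≡ true → Collectable (weight⁺ x) (word⁺ x)
blocks-collectable x@(y , bs) startsWithA k _ =
  (matchingOf k (y ∷ bs) , length-matchingOf k (y ∷ bs) , λ i → edgeSize-matchingOf k i (y ∷ bs)) , clique
  where
  clique : ∀ i j → i ≢ j → normalize (pairWord i j (matchingOf k (y ∷ bs))) ≡ word⁺ x
  clique i j i≢j
    with o , pairs ← pairWord-matchingOf i≢j
    with w , w≡ ← headW-true (word⁺ x) (trans (headW-word⁺ x) (cong just startsWithA))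
    = trans (cong normalize (trans (pairs (y ∷ bs)) (cong (orient o) w≡))) (trans (normalize-orient o w) (sym w≡))

∈generation⇒pattern : ∀ t {P} → P ∈ map word⁺ (generation t) → IsPattern (suc t) P
∈generation⇒pattern t P∈ with (y , bs) , x∈ , refl ← ∈-map⁻ word⁺ P∈ with weightₓ , letterₓ ← ∈-generation⁻ t x∈ =
  trans (length-wordOf (y ∷ bs)) (trans (cong₂ _+_ weightₓ weightₓ) (cong (suc t +_) (sym (+-identityʳ (suc t))))) ,
  trans (count-wordOf true (y ∷ bs)) weightₓ ,
  trans (headW-word⁺ (y , bs)) (cong just letterₓ)

∈generation⇒collectable : ∀ t {P} → P ∈ map word⁺ (generation t) → Collectable (suc t) P
∈generation⇒collectable t P∈ with x , x∈ , refl ← ∈-map⁻ word⁺ P∈ with weightₓ , letterₓ ← ∈-generation⁻ t x∈ =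
  subst (λ r → Collectable r (word⁺ x)) weightₓ (blocks-collectable x letterₓ)

collectable⇔∈generation : ∀ t P → IsPattern (suc t) P → Collectable (suc t) P ⇔ P ∈ map word⁺ (generation t)
collectable⇔∈generation t P pat =
  mk⇔ (lateTurn-free⇒∈generation t P pat ∘ collectable⇒lateTurn-free pat) (∈generation⇒collectable t)

corollary2p2 : ∀ (r : ℕ) → 2 ≤ r →
    Σ (List Word) λ L →
      Unique L × All (IsPattern r) L
      × (∀ (P : Word) → IsPattern r P → (Collectable r P ⇔ P ∈ L))
      × length L ≡ 3 ^ (r ∸ 1)
      × sum (map maturity L) ≡ (3 ^ (r ∸ 2) ∸ 1) / 2
corollary2p2 (suc (suc t)) (s≤s (s≤s z≤n)) =
  map word⁺ (generation (suc t)) ,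
  Unique.map⁺ word⁺-injective (generation-unique (suc t)) ,
  All.tabulate (∈generation⇒pattern (suc t)) ,
  collectable⇔∈generation (suc t) ,
  trans (length-map word⁺ (generation (suc t))) (length-generation (suc t)) ,
  trans (cong sum (sym (map-∘ (generation (suc t))))) (trans (sum-maturity-generation t) (totalExponent≡[3^t∸1]/2 t))
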